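{- Let $a, b, c$ be integers satisfying $$\gcd\left(a^2 - 2bc,\ 2c^2 - ab,\ b^2 - ac\right) = 1 \quad\text{and}\quad a^3 + 2b^3 + 4c^3 - 6abc > 0.$$ Let $u, v, w$ be integers satisfying $$u(a^2 - 2bc) + v(2c^2 - ab) + w(b^2 - ac) = 1.$$ Define $$m = a^3 + 2b^3 + 4c^3 - 6abc, \qquad -\nu = a(bw - av) + 2c(au - cw) + 2b(cv - bu).$$ Then $\nu^3 \equiv 2 \pmod m$. Moreover, triples $(a,b,c)$ for which the elements $a + b2^{1/3} + c2^{2/3}$ lie in different orbits of the action of the unit group $\mathcal{U} = \langle -1,\ 1 + 2^{1/3} + 2^{2/3}\rangle$ on $\mathbb{Z}[2^{1/3}]$ (by multiplication) give distinct pairs $(m, \nu \bmod m)$.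
   Context: $\mathcal{U}$ denotes the unit group of $\mathbb{Z}[2^{1/3}]$, which is generated by $-1$ and the fundamental unit $1 + 2^{1/3} + 2^{2/3}$. -}

module Defs where

open import Data.Integer using (ℤ; +_; -[1+_]; _+_; _-_; _*_; -_; _^_; _>_; 0ℤ; 1ℤ)
open import Data.Integer.GCD using (gcd)
open import Data.Integer.Divisibility using (_∣_)
open import Data.Nat using (ℕ; zero; suc)
open import Data.Product using (_×_; ∃-syntax)
open import Data.Sum using (_⊎_)
open import Relation.Binary.PropositionalEquality using (_≡_)

-- Elements a + b·θ + c·θ² of ℤ[θ], θ = 2^{1/3}, as integer triples.
record Z3 : Set where
  constructor ⟨_,_,_⟩
  field
    c0 c1 c2 : ℤ

-- Multiplication in ℤ[θ] using θ³ = 2.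
_·_ : Z3 → Z3 → Z3
⟨ a , b , c ⟩ · ⟨ d , e , f ⟩ =
  ⟨ a * d + + 2 * (b * f + c * e)
  , a * e + b * d + + 2 * (c * f)
  , a * f + b * e + c * d ⟩

neg : Z3 → Z3
neg ⟨ a , b , c ⟩ = ⟨ - a , - b , - c ⟩

one : Z3
one = ⟨ 1ℤ , 0ℤ , 0ℤ ⟩

-- fundamental unit ε = 1 + θ + θ² and its inverse ε⁻¹ = -1 + θ  ((θ-1)(θ²+θ+1) = θ³-1 = 1)
ε : Z3
ε = ⟨ 1ℤ , 1ℤ , 1ℤ ⟩

ε⁻¹ : Z3
ε⁻¹ = ⟨ - 1ℤ , 1ℤ , 0ℤ ⟩

pow : Z3 → ℕ → Z3
pow x zero = one
pow x (suc n) = x · pow x n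

εpow : ℤ → Z3
εpow (+ n) = pow ε n
εpow -[1+ n ] = pow ε⁻¹ (suc n)

-- x and y lie in the same orbit of 𝒰 = ⟨-1, ε⟩ = {±ε^k} acting by multiplication
SameOrbit : Z3 → Z3 → Set
SameOrbit x y = ∃[ k ] (y ≡ εpow k · x ⊎ y ≡ neg (εpow k · x))

normM : ℤ → ℤ → ℤ → ℤ
normM a b c = a ^ 3 + + 2 * b ^ 3 + + 4 * c ^ 3 - + 6 * a * b * c

q1 q2 q3 : ℤ → ℤ → ℤ → ℤ
q1 a b c = a ^ 2 - + 2 * b * c
q2 a b c = + 2 * c ^ 2 - a * b
q3 a b c = b ^ 2 - a * c

nu : ℤ → ℤ → ℤ → ℤ → ℤ → ℤ → ℤ
nu a b c u v w = - (a * (b * w - a * v) + + 2 * c * (a * u - c * w) + + 2 * b * (c * v - b * u))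

Hyp : ℤ → ℤ → ℤ → ℤ → ℤ → ℤ → Set
Hyp a b c u v w =
  (gcd (gcd (q1 a b c) (q2 a b c)) (q3 a b c) ≡ 1ℤ)
  × (normM a b c > 0ℤ)
  × (u * q1 a b c + v * q2 a b c + w * q3 a b c ≡ 1ℤ)

-- Write θ = 2^{1/3}, α = a + bθ + cθ², m = N(α). The triple (q1, q2, q3) is the adjugate of α, with
-- α · adj α = m, and the Bézout relation u q1 + v q2 + w q3 = 1 makes (bw − av) + (au − cw)θ + (cv − bu)θ²
-- a cofactor of α with product θ − ν. So θ − ν ∈ (α), while an integer n lies in (α) only if m ∣ n:
-- multiplying by adj α gives m ∣ n qᵢ for all i, and the qᵢ generate 1. Hence m ∣ θ³ − ν³ = 2 − ν³.
-- Every x ∈ ℤ[θ] is congruent to x(ν) = x₀ + x₁ν + x₂ν² modulo θ − ν, and x(ν) ≡ x(ν′) (mod m) when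
-- m ∣ ν − ν′. So if α and α′ have the same m and ν mod m, then m ∣ α′(ν), hence α ∣ α′; equal norms
-- make α′ = ηα with N(η) = 1, and every unit of norm 1 is a power of ε = 1 + θ + θ².
-- That last fact is a descent on size(v) = |v₀| + |v₁| + |v₂|: a unit v ≠ 1 of norm 1 shrinks when
-- multiplied by ε or ε⁻¹. Each octant is covered by a certificate: a tree of subdivisions of cones
-- {n₁g₁ + n₂g₂ + n₃g₃ : nᵢ ∈ ℕ} whose leaves are cones on which either the norm, a cubic form in the nᵢ,
-- has all coefficients of one sign (so that norm 1 is attained at most at a generator), or multiplication
-- by ε^{±1} shrinks every generator and size is linear.
module Submission where

open import Defs
open import Data.Fin using (#_)
open import Data.Integer
  using (ℤ; +_; -[1+_]; _+_; _-_; _*_; -_; _^_; _>_; 0ℤ; 1ℤ; -1ℤ; ∣_∣; sign; _◃_; _≟_; >-nonZero)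
  renaming (suc to sucℤ; pred to predℤ)
import Data.Integer.Divisibility as Unsigned
open import Data.Integer.Divisibility.Signed
  using (_∣_; divides; ∣⇒∣ᵤ; ∣ᵤ⇒∣; ∣m⇒∣m*n; ∣n⇒∣m*n; ∣m∣n⇒∣m+n)
import Data.Integer.Properties as ℤ
open import Data.Integer.Solver using (module +-*-Solver)
open +-*-Solver using (Polynomial; prove; con; var; _:+_; _:*_; _:-_; :-_; _:^_; ⟦_⟧; ⟦_⟧↓)
import Data.Integer.Tactic.RingSolver as ℤ-Solver
open import Data.List using (List; []; _∷_)
open import Data.List.Relation.Unary.All using (All; []; _∷_; all?)
open import Data.Nat as ℕ using (ℕ; zero; suc; z≤n; s≤s)
import Data.Nat.Properties as ℕ
import Data.Nat.Tactic.RingSolver as ℕ-Solver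
open import Data.Product using (_×_; _,_; proj₂; ∃-syntax)
open import Data.Sign as Sign using (Sign)
open import Data.Sum as Sum using (_⊎_; inj₁; inj₂)
open import Data.Vec using (Vec; []; _∷_)
open import Function using (_∘_)
open import Relation.Binary.Definitions using (DecidableEquality)
open import Relation.Binary.PropositionalEquality
open import Relation.Nullary using (¬_; Dec; contradiction)
open import Relation.Nullary.Decidable using (True; map′; toWitness; _×-dec_; _⊎-dec_; _→-dec_)

-- Arithmetic of ℤ[θ]

infixl 6 _⊕_
infixl 7 _⋆_
infix 4 _∣θ_ _≟θ_

_⊕_ : Z3 → Z3 → Z3
⟨ a , b , c ⟩ ⊕ ⟨ d , e , f ⟩ = ⟨ a + d , b + e , c + f ⟩

_⋆_ : ℤ → Z3 → Z3
n ⋆ ⟨ a , b , c ⟩ = ⟨ n * a , n * b , n * c ⟩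

ι : ℤ → Z3
ι n = ⟨ n , 0ℤ , 0ℤ ⟩

θ-_ : ℤ → Z3
θ- n = ⟨ - n , 1ℤ , 0ℤ ⟩

norm : Z3 → ℤ
norm ⟨ a , b , c ⟩ = normM a b c

adjugate : Z3 → Z3
adjugate ⟨ a , b , c ⟩ = ⟨ q1 a b c , q2 a b c , q3 a b c ⟩

evalAt : Z3 → ℤ → ℤ
evalAt ⟨ a , b , c ⟩ n = a + b * n + c * n ^ 2

quotientAt : Z3 → ℤ → Z3
quotientAt ⟨ a , b , c ⟩ n = ⟨ b + c * n , c , 0ℤ ⟩

Z3-ext : ∀ {x y : Z3} → Z3.c0 x ≡ Z3.c0 y → Z3.c1 x ≡ Z3.c1 y → Z3.c2 x ≡ Z3.c2 y → x ≡ y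
Z3-ext refl refl refl = refl

_≟θ_ : DecidableEquality Z3
⟨ a , b , c ⟩ ≟θ ⟨ d , e , f ⟩ =
  map′ (λ (p , q , r) → Z3-ext p q r) (λ x≡y → cong Z3.c0 x≡y , cong Z3.c1 x≡y , cong Z3.c2 x≡y)
       (a ≟ d ×-dec b ≟ e ×-dec c ≟ f)

-- A copy of the arithmetic of ℤ[θ] on polynomial syntax: evaluating it is definitionally the
-- arithmetic above, so identities of ℤ[θ] can be handed to the ring solver of ℤ.
record Z3ᵖ (n : ℕ) : Set where
  constructor ⟨_,_,_⟩ᵖ
  field
    c0 c1 c2 : Polynomial n

⟦_⟧θ ⟦_⟧θ↓ : ∀ {n} → Z3ᵖ n → Vec ℤ n → Z3
⟦ ⟨ p , q , r ⟩ᵖ ⟧θ ρ = ⟨ ⟦ p ⟧ ρ , ⟦ q ⟧ ρ , ⟦ r ⟧ ρ ⟩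
⟦ ⟨ p , q , r ⟩ᵖ ⟧θ↓ ρ = ⟨ ⟦ p ⟧↓ ρ , ⟦ q ⟧↓ ρ , ⟦ r ⟧↓ ρ ⟩

proveθ : ∀ {n} (ρ : Vec ℤ n) x y → ⟦ x ⟧θ↓ ρ ≡ ⟦ y ⟧θ↓ ρ → ⟦ x ⟧θ ρ ≡ ⟦ y ⟧θ ρ
proveθ ρ ⟨ p , q , r ⟩ᵖ ⟨ p′ , q′ , r′ ⟩ᵖ eq =
  Z3-ext (prove ρ p p′ (cong Z3.c0 eq)) (prove ρ q q′ (cong Z3.c1 eq))
         (prove ρ r r′ (cong Z3.c2 eq))

infixr 5 _∷ᶻ_
_∷ᶻ_ : ∀ {n} → Z3 → Vec ℤ n → Vec ℤ (3 ℕ.+ n)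
x ∷ᶻ ρ = Z3.c0 x ∷ Z3.c1 x ∷ Z3.c2 x ∷ ρ

X : ∀ {n} → Z3ᵖ (3 ℕ.+ n)
X = ⟨ var (# 0) , var (# 1) , var (# 2) ⟩ᵖ

Y : ∀ {n} → Z3ᵖ (6 ℕ.+ n)
Y = ⟨ var (# 3) , var (# 4) , var (# 5) ⟩ᵖ

Z : ∀ {n} → Z3ᵖ (9 ℕ.+ n)
Z = ⟨ var (# 6) , var (# 7) , var (# 8) ⟩ᵖ

infixl 6 _⊕ᵖ_
infixl 7 _⋆ᵖ_ _·ᵖ_

_⊕ᵖ_ : ∀ {n} → Z3ᵖ n → Z3ᵖ n → Z3ᵖ n
⟨ a , b , c ⟩ᵖ ⊕ᵖ ⟨ d , e , f ⟩ᵖ = ⟨ a :+ d , b :+ e , c :+ f ⟩ᵖ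

_⋆ᵖ_ : ∀ {n} → Polynomial n → Z3ᵖ n → Z3ᵖ n
t ⋆ᵖ ⟨ a , b , c ⟩ᵖ = ⟨ t :* a , t :* b , t :* c ⟩ᵖ

_·ᵖ_ : ∀ {n} → Z3ᵖ n → Z3ᵖ n → Z3ᵖ n
⟨ a , b , c ⟩ᵖ ·ᵖ ⟨ d , e , f ⟩ᵖ =
  ⟨ a :* d :+ con (+ 2) :* (b :* f :+ c :* e)
  , a :* e :+ b :* d :+ con (+ 2) :* (c :* f)
  , a :* f :+ b :* e :+ c :* d ⟩ᵖ

negᵖ : ∀ {n} → Z3ᵖ n → Z3ᵖ n
negᵖ ⟨ a , b , c ⟩ᵖ = ⟨ :- a , :- b , :- c ⟩ᵖ

constᵖ : ∀ {n} → Z3 → Z3ᵖ n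
constᵖ ⟨ a , b , c ⟩ = ⟨ con a , con b , con c ⟩ᵖ

ιᵖ : ∀ {n} → Polynomial n → Z3ᵖ n
ιᵖ t = ⟨ t , con 0ℤ , con 0ℤ ⟩ᵖ

θ-ᵖ : ∀ {n} → Polynomial n → Z3ᵖ n
θ-ᵖ t = ⟨ :- t , con 1ℤ , con 0ℤ ⟩ᵖ

normᵖ : ∀ {n} → Z3ᵖ n → Polynomial n
normᵖ ⟨ a , b , c ⟩ᵖ =
  a :^ 3 :+ con (+ 2) :* b :^ 3 :+ con (+ 4) :* c :^ 3 :- con (+ 6) :* a :* b :* c

adjugateᵖ : ∀ {n} → Z3ᵖ n → Z3ᵖ n
adjugateᵖ ⟨ a , b , c ⟩ᵖ =
  ⟨ a :^ 2 :- con (+ 2) :* b :* c , con (+ 2) :* c :^ 2 :- a :* b , b :^ 2 :- a :* c ⟩ᵖ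

evalAtᵖ : ∀ {n} → Z3ᵖ n → Polynomial n → Polynomial n
evalAtᵖ ⟨ a , b , c ⟩ᵖ t = a :+ b :* t :+ c :* t :^ 2

quotientAtᵖ : ∀ {n} → Z3ᵖ n → Polynomial n → Z3ᵖ n
quotientAtᵖ ⟨ a , b , c ⟩ᵖ t = ⟨ b :+ c :* t , c , con 0ℤ ⟩ᵖ

·-comm : ∀ x y → x · y ≡ y · x
·-comm x y = proveθ (x ∷ᶻ y ∷ᶻ []) (X ·ᵖ Y) (Y ·ᵖ X) refl

·-assoc : ∀ x y z → (x · y) · z ≡ x · (y · z)
·-assoc x y z = proveθ (x ∷ᶻ y ∷ᶻ z ∷ᶻ []) ((X ·ᵖ Y) ·ᵖ Z) (X ·ᵖ (Y ·ᵖ Z)) refl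

·-distribˡ-⊕ : ∀ x y z → x · (y ⊕ z) ≡ x · y ⊕ x · z
·-distribˡ-⊕ x y z = proveθ (x ∷ᶻ y ∷ᶻ z ∷ᶻ []) (X ·ᵖ (Y ⊕ᵖ Z)) (X ·ᵖ Y ⊕ᵖ X ·ᵖ Z) refl

ι-* : ∀ m n → ι (m * n) ≡ ι m · ι n
ι-* m n = proveθ (m ∷ n ∷ []) (ιᵖ (s :* t)) (ιᵖ s ·ᵖ ιᵖ t) refl
  where s = var (# 0); t = var (# 1)

ι-· : ∀ n x → ι n · x ≡ n ⋆ x
ι-· n x = proveθ (x ∷ᶻ n ∷ []) (ιᵖ t ·ᵖ X) (t ⋆ᵖ X) refl
  where t = var (# 3)

norm-· : ∀ x y → norm (x · y) ≡ norm x * norm y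
norm-· x y = prove (x ∷ᶻ y ∷ᶻ []) (normᵖ (X ·ᵖ Y)) (normᵖ X :* normᵖ Y) refl

·-adjugate : ∀ x → x · adjugate x ≡ ι (norm x)
·-adjugate x = proveθ (x ∷ᶻ []) (X ·ᵖ adjugateᵖ X) (ιᵖ (normᵖ X)) refl

θ-·-cube : ∀ n → (θ- n) · neg ⟨ n ^ 2 , n , 1ℤ ⟩ ≡ ι (n ^ 3 - + 2)
θ-·-cube n =
  proveθ (n ∷ []) (θ-ᵖ t ·ᵖ negᵖ ⟨ t :^ 2 , t , con 1ℤ ⟩ᵖ) (ιᵖ (t :^ 3 :- con (+ 2))) refl
  where t = var (# 0)

θ-division : ∀ x n → x ≡ ι (evalAt x n) ⊕ (θ- n) · quotientAt x n
θ-division x n =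
  proveθ (x ∷ᶻ n ∷ []) X (ιᵖ (evalAtᵖ X t) ⊕ᵖ θ-ᵖ t ·ᵖ quotientAtᵖ X t) refl
  where t = var (# 3)

θ-remainder : ∀ x n → ι (evalAt x n) ≡ x ⊕ (θ- n) · neg (quotientAt x n)
θ-remainder x n =
  proveθ (x ∷ᶻ n ∷ []) (ιᵖ (evalAtᵖ X t)) (X ⊕ᵖ θ-ᵖ t ·ᵖ negᵖ (quotientAtᵖ X t)) refl
  where t = var (# 3)

evalAt-difference : ∀ x n n′ → evalAt x n ≡ evalAt x n′ + (n - n′) * (Z3.c1 x + Z3.c2 x * (n + n′))
evalAt-difference x n n′ =
  prove (x ∷ᶻ n ∷ n′ ∷ []) (evalAtᵖ X t) (evalAtᵖ X t′ :+ (t :- t′) :* (b :+ c :* (t :+ t′))) refl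
  where b = var (# 1); c = var (# 2); t = var (# 3); t′ = var (# 4)

-- Divisibility in ℤ[θ] and the ideal (α) = (m, θ − ν)

record _∣θ_ (x y : Z3) : Set where
  constructor dividesθ
  field
    quotient : Z3
    equality : y ≡ x · quotient

∣θ-refl : ∀ x → x ∣θ x
∣θ-refl x = dividesθ one (proveθ (x ∷ᶻ []) X (X ·ᵖ constᵖ one) refl)

∣θ-·ʳ : ∀ {x y} z → x ∣θ y → x ∣θ y · z
∣θ-·ʳ {x} z (dividesθ δ refl) = dividesθ (δ · z) (·-assoc x δ z)

∣θ-⊕ : ∀ {x y z} → x ∣θ y → x ∣θ z → x ∣θ y ⊕ z
∣θ-⊕ {x} (dividesθ δ refl) (dividesθ δ′ refl) = dividesθ (δ ⊕ δ′) (sym (·-distribˡ-⊕ x δ δ′))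

cofactor : ℤ → ℤ → ℤ → ℤ → ℤ → ℤ → Z3
cofactor a b c u v w = ⟨ b * w - a * v , a * u - c * w , c * v - b * u ⟩

·-cofactor : ∀ a b c u v w → ⟨ a , b , c ⟩ · cofactor a b c u v w
  ≡ ⟨ - nu a b c u v w , u * q1 a b c + v * q2 a b c + w * q3 a b c , 0ℤ ⟩
·-cofactor a b c u v w =
  proveθ (a ∷ b ∷ c ∷ u ∷ v ∷ w ∷ []) (X ·ᵖ cofactorᵖ)
    ⟨ :- nuᵖ , U :* q₁ :+ V :* q₂ :+ W :* q₃ , con 0ℤ ⟩ᵖ refl
  where
  A B C U V W : Polynomial 6
  A = var (# 0); B = var (# 1); C = var (# 2); U = var (# 3); V = var (# 4); W = var (# 5)
  cofactorᵖ = ⟨ B :* W :- A :* V , A :* U :- C :* W , C :* V :- B :* U ⟩ᵖ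
  nuᵖ = :- (A :* (B :* W :- A :* V) :+ con (+ 2) :* C :* (A :* U :- C :* W)
            :+ con (+ 2) :* B :* (C :* V :- B :* U))
  q₁ = Z3ᵖ.c0 (adjugateᵖ X)
  q₂ = Z3ᵖ.c1 (adjugateᵖ X)
  q₃ = Z3ᵖ.c2 (adjugateᵖ X)

factor-n : ∀ n u v w x y z → u * (n * x) + v * (n * y) + w * (n * z) ≡ n * (u * x + v * y + w * z)
factor-n = ℤ-Solver.solve-∀

module Ideal (a b c u v w : ℤ) (bezout : u * q1 a b c + v * q2 a b c + w * q3 a b c ≡ 1ℤ) where

  α : Z3
  α = ⟨ a , b , c ⟩

  m ν : ℤ
  m = normM a b c
  ν = nu a b c u v w

  α∣θ-ν : α ∣θ θ- ν
  α∣θ-ν = dividesθ (cofactor a b c u v w)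
    (sym (trans (·-cofactor a b c u v w) (cong (λ l → ⟨ - ν , l , 0ℤ ⟩) bezout)))

  ∣θι⇒∣ : ∀ {n} → α ∣θ ι n → m ∣ n
  ∣θι⇒∣ {n} (dividesθ δ ιn≡αδ) = subst (m ∣_) combination≡n
    (∣m∣n⇒∣m+n (∣m∣n⇒∣m+n (∣n⇒∣m*n u (m∣ (cong Z3.c0 scaled)))
                           (∣n⇒∣m*n v (m∣ (cong Z3.c1 scaled))))
               (∣n⇒∣m*n w (m∣ (cong Z3.c2 scaled))))
    where
    scaled : n ⋆ adjugate α ≡ m ⋆ δ
    scaled = begin
      n ⋆ adjugate α           ≡⟨ ι-· n (adjugate α) ⟨
      ι n · adjugate α         ≡⟨ cong (_· adjugate α) ιn≡αδ ⟩
      (α · δ) · adjugate α     ≡⟨ ·-assoc α δ (adjugate α) ⟩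
      α · (δ · adjugate α)     ≡⟨ cong (α ·_) (·-comm δ (adjugate α)) ⟩
      α · (adjugate α · δ)     ≡⟨ ·-assoc α (adjugate α) δ ⟨
      (α · adjugate α) · δ     ≡⟨ cong (_· δ) (·-adjugate α) ⟩
      ι m · δ                  ≡⟨ ι-· m δ ⟩
      m ⋆ δ                    ∎
      where open ≡-Reasoning
    m∣ : ∀ {k d} → k ≡ m * d → m ∣ k
    m∣ {d = d} k≡md = divides d (trans k≡md (ℤ.*-comm m d))
    combination≡n : u * (n * q1 a b c) + v * (n * q2 a b c) + w * (n * q3 a b c) ≡ n
    combination≡n = begin
      u * (n * q1 a b c) + v * (n * q2 a b c) + w * (n * q3 a b c)
        ≡⟨ factor-n n u v w (q1 a b c) (q2 a b c) (q3 a b c) ⟩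
      n * (u * q1 a b c + v * q2 a b c + w * q3 a b c)  ≡⟨ cong (n *_) bezout ⟩
      n * 1ℤ                                            ≡⟨ ℤ.*-identityʳ n ⟩
      n                                                 ∎
      where open ≡-Reasoning

  ∣⇒∣θι : ∀ {n} → m ∣ n → α ∣θ ι n
  ∣⇒∣θι (divides k refl) = dividesθ (adjugate α · ι k) (begin
    ι (k * m)                  ≡⟨ cong ι (ℤ.*-comm k m) ⟩
    ι (m * k)                  ≡⟨ ι-* m k ⟩
    ι m · ι k                  ≡⟨ cong (_· ι k) (·-adjugate α) ⟨
    (α · adjugate α) · ι k     ≡⟨ ·-assoc α (adjugate α) (ι k) ⟩
    α · (adjugate α · ι k)     ∎)
    where open ≡-Reasoning

  m∣ν³-2 : m ∣ ν ^ 3 - + 2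
  m∣ν³-2 = ∣θι⇒∣ (subst (α ∣θ_) (θ-·-cube ν) (∣θ-·ʳ _ α∣θ-ν))

  m∣evalAt-ν : m ∣ evalAt α ν
  m∣evalAt-ν =
    ∣θι⇒∣ (subst (α ∣θ_) (sym (θ-remainder α ν)) (∣θ-⊕ (∣θ-refl α) (∣θ-·ʳ _ α∣θ-ν)))

  m∣evalAt⇒∣θ : ∀ {x} → m ∣ evalAt x ν → α ∣θ x
  m∣evalAt⇒∣θ {x} m∣xν =
    subst (α ∣θ_) (sym (θ-division x ν)) (∣θ-⊕ (∣⇒∣θι m∣xν) (∣θ-·ʳ _ α∣θ-ν))

-- Units of norm 1

size : Z3 → ℕ
size ⟨ a , b , c ⟩ = ∣ a ∣ ℕ.+ ∣ b ∣ ℕ.+ ∣ c ∣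

data Shift : Set where
  byε byε⁻¹ : Shift

factor : Shift → Z3
factor byε = ε
factor byε⁻¹ = ε⁻¹

Descent : Z3 → Set
Descent v = norm v ≡ 1ℤ → v ≡ one ⊎ ∃[ d ] size (factor d · v) ℕ.< size v

descent? : ∀ v → Dec (Descent v)
descent? v = norm v ≟ 1ℤ →-dec (v ≟θ one ⊎-dec shrinks?)
  where
  shrinks? : Dec (∃[ d ] size (factor d · v) ℕ.< size v)
  shrinks? = map′ (λ { (inj₁ p) → byε , p ; (inj₂ p) → byε⁻¹ , p })
                  (λ { (byε , p) → inj₁ p ; (byε⁻¹ , p) → inj₂ p })
                  (size (ε · v) ℕ.<? size v ⊎-dec size (ε⁻¹ · v) ℕ.<? size v)

-- Cones and the norm form on them

record Cone : Set where
  constructor cone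
  field
    g₁ g₂ g₃ : Z3

combination : Cone → ℤ → ℤ → ℤ → Z3
combination (cone x y z) t₁ t₂ t₃ = t₁ ⋆ x ⊕ t₂ ⋆ y ⊕ t₃ ⋆ z

point : Cone → ℕ → ℕ → ℕ → Z3
point C n₁ n₂ n₃ = combination C (+ n₁) (+ n₂) (+ n₃)

Covered : Cone → Set
Covered C = ∀ n₁ n₂ n₃ → Descent (point C n₁ n₂ n₃)

Generators : (Z3 → Set) → Cone → Set
Generators P (cone x y z) = P x × P y × P z

generators? : ∀ {P} → (∀ v → Dec (P v)) → ∀ C → Dec (Generators P C)
generators? P? (cone x y z) = P? x ×-dec P? y ×-dec P? z

combinationᵖ : ∀ {n} → Z3ᵖ n → Z3ᵖ n → Z3ᵖ n → (t₁ t₂ t₃ : Polynomial n) → Z3ᵖ n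
combinationᵖ x y z t₁ t₂ t₃ = t₁ ⋆ᵖ x ⊕ᵖ t₂ ⋆ᵖ y ⊕ᵖ t₃ ⋆ᵖ z

cone-env : ∀ {n} → Cone → Vec ℤ n → Vec ℤ (9 ℕ.+ n)
cone-env (cone x y z) ρ = x ∷ᶻ y ∷ᶻ z ∷ᶻ ρ

T₁ T₂ T₃ : Polynomial 12
T₁ = var (# 9)
T₂ = var (# 10)
T₃ = var (# 11)

_·ᶜ_ : Z3 → Cone → Cone
u ·ᶜ cone x y z = cone (u · x) (u · y) (u · z)

norm-origin : ∀ C → norm (point C 0 0 0) ≡ 0ℤ
norm-origin C = prove (cone-env C []) (normᵖ (combinationᵖ X Y Z 0ᵖ 0ᵖ 0ᵖ)) 0ᵖ refl
  where 0ᵖ = con 0ℤ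

origin-not-unit : ∀ C → norm (point C 0 0 0) ≢ 1ℤ
origin-not-unit C N≡1 = contradiction (trans (sym (norm-origin C)) N≡1) λ ()

combination-e₁ : ∀ C → combination C 1ℤ 0ℤ 0ℤ ≡ Cone.g₁ C
combination-e₁ C = proveθ (cone-env C []) (combinationᵖ X Y Z (con 1ℤ) (con 0ℤ) (con 0ℤ)) X refl

combination-e₂ : ∀ C → combination C 0ℤ 1ℤ 0ℤ ≡ Cone.g₂ C
combination-e₂ C = proveθ (cone-env C []) (combinationᵖ X Y Z (con 0ℤ) (con 1ℤ) (con 0ℤ)) Y refl

combination-e₃ : ∀ C → combination C 0ℤ 0ℤ 1ℤ ≡ Cone.g₃ C
combination-e₃ C = proveθ (cone-env C []) (combinationᵖ X Y Z (con 0ℤ) (con 0ℤ) (con 1ℤ)) Z refl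

·-⋆ : ∀ u t x → u · (t ⋆ x) ≡ t ⋆ (u · x)
·-⋆ u t x = proveθ (u ∷ᶻ x ∷ᶻ t ∷ []) (X ·ᵖ (var (# 6) ⋆ᵖ Y)) (var (# 6) ⋆ᵖ (X ·ᵖ Y)) refl

·-combination : ∀ u C t₁ t₂ t₃ → u · combination C t₁ t₂ t₃ ≡ combination (u ·ᶜ C) t₁ t₂ t₃
·-combination u (cone x y z) t₁ t₂ t₃ = begin
  u · (t₁ ⋆ x ⊕ t₂ ⋆ y ⊕ t₃ ⋆ z)                    ≡⟨ ·-distribˡ-⊕ u _ _ ⟩
  u · (t₁ ⋆ x ⊕ t₂ ⋆ y) ⊕ u · (t₃ ⋆ z)              ≡⟨ cong (_⊕ u · (t₃ ⋆ z)) (·-distribˡ-⊕ u _ _) ⟩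
  u · (t₁ ⋆ x) ⊕ u · (t₂ ⋆ y) ⊕ u · (t₃ ⋆ z)
    ≡⟨ cong₂ _⊕_ (cong₂ _⊕_ (·-⋆ u t₁ x) (·-⋆ u t₂ y)) (·-⋆ u t₃ z) ⟩
  t₁ ⋆ (u · x) ⊕ t₂ ⋆ (u · y) ⊕ t₃ ⋆ (u · z)        ∎
  where open ≡-Reasoning

data Pair : Set where
  ₁₂ ₁₃ ₂₃ : Pair

lower upper : Pair → Cone → Cone
lower ₁₂ (cone x y z) = cone x (x ⊕ y) z
lower ₁₃ (cone x y z) = cone x y (x ⊕ z)
lower ₂₃ (cone x y z) = cone x y (y ⊕ z)
upper ₁₂ (cone x y z) = cone (y ⊕ x) y z
upper ₁₃ (cone x y z) = cone (z ⊕ x) y z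
upper ₂₃ (cone x y z) = cone x (z ⊕ y) z

lower₁₂ : ∀ C s t₂ t₃ → combination (lower ₁₂ C) s t₂ t₃ ≡ combination C (t₂ + s) t₂ t₃
lower₁₂ C s t₂ t₃ =
  proveθ (cone-env C (s ∷ t₂ ∷ t₃ ∷ [])) (combinationᵖ X (X ⊕ᵖ Y) Z T₁ T₂ T₃)
    (combinationᵖ X Y Z (T₂ :+ T₁) T₂ T₃) refl

upper₁₂ : ∀ C t₁ s t₃ → combination (upper ₁₂ C) t₁ s t₃ ≡ combination C t₁ (t₁ + s) t₃
upper₁₂ C t₁ s t₃ =
  proveθ (cone-env C (t₁ ∷ s ∷ t₃ ∷ [])) (combinationᵖ (Y ⊕ᵖ X) Y Z T₁ T₂ T₃)
    (combinationᵖ X Y Z T₁ (T₁ :+ T₂) T₃) refl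

lower₁₃ : ∀ C s t₂ t₃ → combination (lower ₁₃ C) s t₂ t₃ ≡ combination C (t₃ + s) t₂ t₃
lower₁₃ C s t₂ t₃ =
  proveθ (cone-env C (s ∷ t₂ ∷ t₃ ∷ [])) (combinationᵖ X Y (X ⊕ᵖ Z) T₁ T₂ T₃)
    (combinationᵖ X Y Z (T₃ :+ T₁) T₂ T₃) refl

upper₁₃ : ∀ C t₁ t₂ s → combination (upper ₁₃ C) t₁ t₂ s ≡ combination C t₁ t₂ (t₁ + s)
upper₁₃ C t₁ t₂ s =
  proveθ (cone-env C (t₁ ∷ t₂ ∷ s ∷ [])) (combinationᵖ (Z ⊕ᵖ X) Y Z T₁ T₂ T₃)
    (combinationᵖ X Y Z T₁ T₂ (T₁ :+ T₃)) refl

lower₂₃ : ∀ C t₁ s t₃ → combination (lower ₂₃ C) t₁ s t₃ ≡ combination C t₁ (t₃ + s) t₃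
lower₂₃ C t₁ s t₃ =
  proveθ (cone-env C (t₁ ∷ s ∷ t₃ ∷ [])) (combinationᵖ X Y (Y ⊕ᵖ Z) T₁ T₂ T₃)
    (combinationᵖ X Y Z T₁ (T₃ :+ T₂) T₃) refl

upper₂₃ : ∀ C t₁ t₂ s → combination (upper ₂₃ C) t₁ t₂ s ≡ combination C t₁ t₂ (t₂ + s)
upper₂₃ C t₁ t₂ s =
  proveθ (cone-env C (t₁ ∷ t₂ ∷ s ∷ [])) (combinationᵖ X (Z ⊕ᵖ Y) Z T₁ T₂ T₃)
    (combinationᵖ X Y Z T₁ T₂ (T₂ :+ T₃)) refl

difference : ∀ m n → (∃[ s ] n ℕ.+ s ≡ m) ⊎ (∃[ s ] m ℕ.+ s ≡ n)
difference m n =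
  Sum.map (λ n≤m → ℕ.m≤n⇒∃[o]m+o≡n n≤m) (λ m≤n → ℕ.m≤n⇒∃[o]m+o≡n m≤n) (ℕ.≤-total n m)

split-covered : ∀ p C → Covered (lower p C) → Covered (upper p C) → Covered C
split-covered ₁₂ C low up n₁ n₂ n₃ with difference n₁ n₂
... | inj₁ (s , refl) = subst Descent (lower₁₂ C (+ s) (+ n₂) (+ n₃)) (low s n₂ n₃)
... | inj₂ (s , refl) = subst Descent (upper₁₂ C (+ n₁) (+ s) (+ n₃)) (up n₁ s n₃)
split-covered ₁₃ C low up n₁ n₂ n₃ with difference n₁ n₃
... | inj₁ (s , refl) = subst Descent (lower₁₃ C (+ s) (+ n₂) (+ n₃)) (low s n₂ n₃)
... | inj₂ (s , refl) = subst Descent (upper₁₃ C (+ n₁) (+ n₂) (+ s)) (up n₁ n₂ s)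
split-covered ₂₃ C low up n₁ n₂ n₃ with difference n₂ n₃
... | inj₁ (s , refl) = subst Descent (lower₂₃ C (+ n₁) (+ s) (+ n₃)) (low n₁ s n₃)
... | inj₂ (s , refl) = subst Descent (upper₂₃ C (+ n₁) (+ n₂) (+ s)) (up n₁ n₂ s)

Monomial : Set
Monomial = ℕ × ℕ × ℕ

CubicForm : Set
CubicForm = List (Monomial × ℤ)

monomial : Monomial → ℤ → ℤ → ℤ → ℤ
monomial (i , j , k) t₁ t₂ t₃ = t₁ ^ i * t₂ ^ j * t₃ ^ k

monomialℕ : Monomial → ℕ → ℕ → ℕ → ℕ
monomialℕ (i , j , k) n₁ n₂ n₃ = n₁ ℕ.^ i ℕ.* n₂ ℕ.^ j ℕ.* n₃ ℕ.^ k

evaluate : CubicForm → ℤ → ℤ → ℤ → ℤ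
evaluate [] t₁ t₂ t₃ = 0ℤ
evaluate ((μ , c) ∷ f) t₁ t₂ t₃ = monomial μ t₁ t₂ t₃ * c + evaluate f t₁ t₂ t₃

evaluate∣∣ : CubicForm → ℕ → ℕ → ℕ → ℕ
evaluate∣∣ [] n₁ n₂ n₃ = 0
evaluate∣∣ ((μ , c) ∷ f) n₁ n₂ n₃ = monomialℕ μ n₁ n₂ n₃ ℕ.* ∣ c ∣ ℕ.+ evaluate∣∣ f n₁ n₂ n₃

-- polar x y is the coefficient of s²t in norm (s ⋆ x ⊕ t ⋆ y), the derivative of the norm at x in the
-- direction y, which equals 3 · c0 (adjugate x · y).
polar : Z3 → Z3 → ℤ
polar x y = + 3 * Z3.c0 (adjugate x · y)

mixedTerms : Z3 → Z3 → Z3 → CubicForm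
mixedTerms x y z =
  ((2 , 1 , 0) , polar x y) ∷ ((2 , 0 , 1) , polar x z) ∷ ((1 , 2 , 0) , polar y x) ∷
  ((0 , 2 , 1) , polar y z) ∷ ((1 , 0 , 2) , polar z x) ∷ ((0 , 1 , 2) , polar z y) ∷
  ((1 , 1 , 1) , polar (x ⊕ y) z - polar x z - polar y z) ∷ []

normForm : Cone → CubicForm
normForm (cone x y z) =
  ((3 , 0 , 0) , norm x) ∷ ((0 , 3 , 0) , norm y) ∷ ((0 , 0 , 3) , norm z) ∷ mixedTerms x y z

evaluateᵖ : ∀ {n} → List (Monomial × Polynomial n) → (t₁ t₂ t₃ : Polynomial n) → Polynomial n
evaluateᵖ [] t₁ t₂ t₃ = con 0ℤ
evaluateᵖ (((i , j , k) , c) ∷ f) t₁ t₂ t₃ =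
  t₁ :^ i :* t₂ :^ j :* t₃ :^ k :* c :+ evaluateᵖ f t₁ t₂ t₃

polarᵖ : ∀ {n} → Z3ᵖ n → Z3ᵖ n → Polynomial n
polarᵖ x y = con (+ 3) :* Z3ᵖ.c0 (adjugateᵖ x ·ᵖ y)

normFormᵖ : ∀ {n} → Z3ᵖ n → Z3ᵖ n → Z3ᵖ n → List (Monomial × Polynomial n)
normFormᵖ x y z =
  ((3 , 0 , 0) , normᵖ x) ∷ ((0 , 3 , 0) , normᵖ y) ∷ ((0 , 0 , 3) , normᵖ z) ∷
  ((2 , 1 , 0) , polarᵖ x y) ∷ ((2 , 0 , 1) , polarᵖ x z) ∷ ((1 , 2 , 0) , polarᵖ y x) ∷
  ((0 , 2 , 1) , polarᵖ y z) ∷ ((1 , 0 , 2) , polarᵖ z x) ∷ ((0 , 1 , 2) , polarᵖ z y) ∷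
  ((1 , 1 , 1) , polarᵖ (x ⊕ᵖ y) z :- polarᵖ x z :- polarᵖ y z) ∷ []

norm-combination : ∀ C t₁ t₂ t₃ → norm (combination C t₁ t₂ t₃) ≡ evaluate (normForm C) t₁ t₂ t₃
norm-combination C t₁ t₂ t₃ = prove (cone-env C (t₁ ∷ t₂ ∷ t₃ ∷ []))
  (normᵖ (combinationᵖ X Y Z T₁ T₂ T₃)) (evaluateᵖ (normFormᵖ X Y Z) T₁ T₂ T₃) refl

Signed : Sign → ℤ → Set
Signed s c = s ◃ ∣ c ∣ ≡ c

SignedForm : Sign → CubicForm → Set
SignedForm s = All (Signed s ∘ proj₂)

signedForm? : ∀ s f → Dec (SignedForm s f)
signedForm? s = all? (λ (_ , c) → s ◃ ∣ c ∣ ≟ c)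

+*◃ : ∀ n s k → + n * (s ◃ k) ≡ s ◃ (n ℕ.* k)
+*◃ n s k = trans (cong (_* (s ◃ k)) (sym (ℤ.+◃n≡+n n))) (sym (ℤ.◃-distrib-* Sign.+ s n k))

+-^ : ∀ n i → (+ n) ^ i ≡ + (n ℕ.^ i)
+-^ n zero = refl
+-^ n (suc i) = trans (cong (+ n *_) (+-^ n i)) (sym (ℤ.pos-* n (n ℕ.^ i)))

monomial-+ : ∀ μ n₁ n₂ n₃ → monomial μ (+ n₁) (+ n₂) (+ n₃) ≡ + monomialℕ μ n₁ n₂ n₃
monomial-+ (i , j , k) n₁ n₂ n₃ rewrite +-^ n₁ i | +-^ n₂ j | +-^ n₃ k =
  trans (cong (_* + (n₃ ℕ.^ k)) (sym (ℤ.pos-* (n₁ ℕ.^ i) (n₂ ℕ.^ j))))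
        (sym (ℤ.pos-* (n₁ ℕ.^ i ℕ.* n₂ ℕ.^ j) (n₃ ℕ.^ k)))

evaluate-signed : ∀ {s f} n₁ n₂ n₃ → SignedForm s f →
  evaluate f (+ n₁) (+ n₂) (+ n₃) ≡ s ◃ evaluate∣∣ f n₁ n₂ n₃
evaluate-signed n₁ n₂ n₃ [] = refl
evaluate-signed {s} {(μ , c) ∷ f} n₁ n₂ n₃ (c-signed ∷ f-signed) = begin
  monomial μ (+ n₁) (+ n₂) (+ n₃) * c + evaluate f (+ n₁) (+ n₂) (+ n₃)
    ≡⟨ cong₂ _+_ (cong₂ _*_ (monomial-+ μ n₁ n₂ n₃) (sym c-signed)) (evaluate-signed n₁ n₂ n₃ f-signed) ⟩
  + M * (s ◃ ∣ c ∣) + (s ◃ evaluate∣∣ f n₁ n₂ n₃)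
    ≡⟨ cong (_+ (s ◃ evaluate∣∣ f n₁ n₂ n₃)) (+*◃ M s ∣ c ∣) ⟩
  (s ◃ (M ℕ.* ∣ c ∣)) + (s ◃ evaluate∣∣ f n₁ n₂ n₃)
    ≡⟨ ℤ.◃-distrib-+ s (M ℕ.* ∣ c ∣) _ ⟨
  s ◃ (M ℕ.* ∣ c ∣ ℕ.+ evaluate∣∣ f n₁ n₂ n₃) ∎
  where
  open ≡-Reasoning
  M = monomialℕ μ n₁ n₂ n₃

n≤n³*c : ∀ n {c} → 1 ℕ.≤ c → n ℕ.≤ n ℕ.^ 3 ℕ.* c
n≤n³*c n {c} 1≤c = ℕ.≤-trans (n≤n³ n) (ℕ.m≤m*n (n ℕ.^ 3) c {{ℕ.>-nonZero 1≤c}})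
  where
  n≤n³ : ∀ n → n ℕ.≤ n ℕ.^ 3
  n≤n³ zero = z≤n
  n≤n³ (suc k) = ℕ.m≤m*n (suc k) (suc k ℕ.^ 2)

cubes-bound : ∀ {c₁ c₂ c₃} f n₁ n₂ n₃ → 1 ℕ.≤ ∣ c₁ ∣ → 1 ℕ.≤ ∣ c₂ ∣ → 1 ℕ.≤ ∣ c₃ ∣ →
  n₁ ℕ.+ n₂ ℕ.+ n₃ ℕ.≤
    evaluate∣∣ (((3 , 0 , 0) , c₁) ∷ ((0 , 3 , 0) , c₂) ∷ ((0 , 0 , 3) , c₃) ∷ f) n₁ n₂ n₃
cubes-bound {c₁} {c₂} {c₃} f n₁ n₂ n₃ 1≤c₁ 1≤c₂ 1≤c₃ = begin
  n₁ ℕ.+ n₂ ℕ.+ n₃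
    ≤⟨ ℕ.+-mono-≤ (ℕ.+-mono-≤ (n≤n³*c n₁ 1≤c₁) (n≤n³*c n₂ 1≤c₂)) (n≤n³*c n₃ 1≤c₃) ⟩
  term₁ ℕ.+ term₂ ℕ.+ term₃
    ≡⟨ ℕ.+-assoc term₁ term₂ term₃ ⟩
  term₁ ℕ.+ (term₂ ℕ.+ term₃)
    ≤⟨ ℕ.+-monoʳ-≤ term₁ (ℕ.+-monoʳ-≤ term₂ (ℕ.m≤m+n term₃ rest)) ⟩
  term₁ ℕ.+ (term₂ ℕ.+ (term₃ ℕ.+ rest))
    ≡⟨ cong₂ ℕ._+_ (cong (ℕ._* ∣ c₁ ∣) (sym one₁))
                   (cong₂ ℕ._+_ (cong (ℕ._* ∣ c₂ ∣) (sym one₂))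
                                (cong (λ t → t ℕ.* ∣ c₃ ∣ ℕ.+ rest) (sym one₃))) ⟩
  _ ∎
  where
  open ℕ.≤-Reasoning
  term₁ = n₁ ℕ.^ 3 ℕ.* ∣ c₁ ∣
  term₂ = n₂ ℕ.^ 3 ℕ.* ∣ c₂ ∣
  term₃ = n₃ ℕ.^ 3 ℕ.* ∣ c₃ ∣
  rest = evaluate∣∣ f n₁ n₂ n₃
  one₁ : n₁ ℕ.^ 3 ℕ.* 1 ℕ.* 1 ≡ n₁ ℕ.^ 3
  one₁ = trans (ℕ.*-identityʳ _) (ℕ.*-identityʳ _)
  one₂ : 1 ℕ.* n₂ ℕ.^ 3 ℕ.* 1 ≡ n₂ ℕ.^ 3
  one₂ = trans (ℕ.*-identityʳ _) (ℕ.*-identityˡ _)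
  one₃ : 1 ℕ.* 1 ℕ.* n₃ ℕ.^ 3 ≡ n₃ ℕ.^ 3
  one₃ = ℕ.*-identityˡ _

-- Certificates

norm-point-signed : ∀ {s} C n₁ n₂ n₃ → SignedForm s (normForm C) →
  norm (point C n₁ n₂ n₃) ≡ s ◃ evaluate∣∣ (normForm C) n₁ n₂ n₃
norm-point-signed C n₁ n₂ n₃ signed =
  trans (norm-combination C (+ n₁) (+ n₂) (+ n₃)) (evaluate-signed n₁ n₂ n₃ signed)

PositiveLeaf : Cone → Set
PositiveLeaf C = SignedForm Sign.+ (normForm C) × Generators (λ g → 1 ℕ.≤ ∣ norm g ∣ × Descent g) C

data Basis : ℕ → ℕ → ℕ → Set where
  origin : Basis 0 0 0
  e₁ : Basis 1 0 0
  e₂ : Basis 0 1 0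
  e₃ : Basis 0 0 1

basis : ∀ n₁ n₂ n₃ → n₁ ℕ.+ n₂ ℕ.+ n₃ ℕ.≤ 1 → Basis n₁ n₂ n₃
basis 0 0 0 _ = origin
basis 1 0 0 _ = e₁
basis 0 1 0 _ = e₂
basis 0 0 1 _ = e₃
basis 0 0 (suc (suc _)) (s≤s ())
basis 0 1 (suc _) (s≤s ())
basis 0 (suc (suc _)) _ (s≤s ())
basis 1 0 (suc _) (s≤s ())
basis 1 (suc _) _ (s≤s ())
basis (suc (suc _)) _ _ (s≤s ())

positive-value : ∀ C n₁ n₂ n₃ → SignedForm Sign.+ (normForm C) → norm (point C n₁ n₂ n₃) ≡ 1ℤ →
  evaluate∣∣ (normForm C) n₁ n₂ n₃ ≡ 1
positive-value C n₁ n₂ n₃ signed N≡1 = ℤ.+-injective (begin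
  + value                  ≡⟨ ℤ.+◃n≡+n value ⟨
  Sign.+ ◃ value           ≡⟨ norm-point-signed C n₁ n₂ n₃ signed ⟨
  norm (point C n₁ n₂ n₃)  ≡⟨ N≡1 ⟩
  1ℤ                       ∎)
  where
  open ≡-Reasoning
  value = evaluate∣∣ (normForm C) n₁ n₂ n₃

positive-covered : ∀ C → PositiveLeaf C → Covered C
positive-covered C@(cone x y z) (signed , (1≤∣Nx∣ , Dx) , (1≤∣Ny∣ , Dy) , (1≤∣Nz∣ , Dz)) n₁ n₂ n₃ N≡1 =
  at (basis n₁ n₂ n₃ (subst (n₁ ℕ.+ n₂ ℕ.+ n₃ ℕ.≤_) (positive-value C n₁ n₂ n₃ signed N≡1) bound)) N≡1
  where
  bound = cubes-bound {norm x} {norm y} {norm z} (mixedTerms x y z) n₁ n₂ n₃ 1≤∣Nx∣ 1≤∣Ny∣ 1≤∣Nz∣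
  at : ∀ {m₁ m₂ m₃} → Basis m₁ m₂ m₃ → Descent (point C m₁ m₂ m₃)
  at origin N≡1 = contradiction N≡1 (origin-not-unit C)
  at e₁ = subst Descent (sym (combination-e₁ C)) Dx
  at e₂ = subst Descent (sym (combination-e₂ C)) Dy
  at e₃ = subst Descent (sym (combination-e₃ C)) Dz

-◃≢1 : ∀ n → Sign.- ◃ n ≢ 1ℤ
-◃≢1 zero ()
-◃≢1 (suc n) ()

negative-covered : ∀ C → SignedForm Sign.- (normForm C) → Covered C
negative-covered C signed n₁ n₂ n₃ N≡1 =
  contradiction (trans (sym (norm-point-signed C n₁ n₂ n₃ signed)) N≡1) (-◃≢1 _)

AllSigned : Sign → ℤ → ℤ → ℤ → Set
AllSigned s a b c = Signed s a × Signed s b × Signed s c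

SameSign : ℤ → ℤ → ℤ → Set
SameSign a b c = AllSigned Sign.+ a b c ⊎ AllSigned Sign.- a b c

sameSign? : ∀ a b c → Dec (SameSign a b c)
sameSign? a b c = allSigned? Sign.+ ⊎-dec allSigned? Sign.-
  where
  allSigned? : ∀ s → Dec (AllSigned s a b c)
  allSigned? s = s ◃ ∣ a ∣ ≟ a ×-dec s ◃ ∣ b ∣ ≟ b ×-dec s ◃ ∣ c ∣ ≟ c

Coherent : Cone → Set
Coherent (cone x y z) =
  SameSign (Z3.c0 x) (Z3.c0 y) (Z3.c0 z) ×
  SameSign (Z3.c1 x) (Z3.c1 y) (Z3.c1 z) ×
  SameSign (Z3.c2 x) (Z3.c2 y) (Z3.c2 z)

coherent? : ∀ C → Dec (Coherent C)
coherent? (cone x y z) =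
  sameSign? (Z3.c0 x) (Z3.c0 y) (Z3.c0 z) ×-dec
  sameSign? (Z3.c1 x) (Z3.c1 y) (Z3.c1 z) ×-dec
  sameSign? (Z3.c2 x) (Z3.c2 y) (Z3.c2 z)

signed-row-size : ∀ {s a b c} n₁ n₂ n₃ → AllSigned s a b c →
  ∣ + n₁ * a + + n₂ * b + + n₃ * c ∣ ≡ n₁ ℕ.* ∣ a ∣ ℕ.+ n₂ ℕ.* ∣ b ∣ ℕ.+ n₃ ℕ.* ∣ c ∣
signed-row-size {s} {a} {b} {c} n₁ n₂ n₃ (a-signed , b-signed , c-signed) = begin
  ∣ + n₁ * a + + n₂ * b + + n₃ * c ∣
    ≡⟨ cong ∣_∣ (cong₂ _+_ (cong₂ _+_ (scaled n₁ a-signed) (scaled n₂ b-signed)) (scaled n₃ c-signed)) ⟩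
  ∣ (s ◃ A) + (s ◃ B) + (s ◃ C) ∣
    ≡⟨ cong ∣_∣ (trans (ℤ.◃-distrib-+ s (A ℕ.+ B) C) (cong (_+ (s ◃ C)) (ℤ.◃-distrib-+ s A B))) ⟨
  ∣ s ◃ (A ℕ.+ B ℕ.+ C) ∣
    ≡⟨ ℤ.abs-◃ s _ ⟩
  A ℕ.+ B ℕ.+ C ∎
  where
  open ≡-Reasoning
  A = n₁ ℕ.* ∣ a ∣
  B = n₂ ℕ.* ∣ b ∣
  C = n₃ ℕ.* ∣ c ∣
  scaled : ∀ n {x} → Signed s x → + n * x ≡ s ◃ (n ℕ.* ∣ x ∣)
  scaled n {x} x-signed = trans (cong (+ n *_) (sym x-signed)) (+*◃ n s ∣ x ∣)

row-size : ∀ {a b c} n₁ n₂ n₃ → SameSign a b c →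
  ∣ + n₁ * a + + n₂ * b + + n₃ * c ∣ ≡ n₁ ℕ.* ∣ a ∣ ℕ.+ n₂ ℕ.* ∣ b ∣ ℕ.+ n₃ ℕ.* ∣ c ∣
row-size n₁ n₂ n₃ (inj₁ signed) = signed-row-size n₁ n₂ n₃ signed
row-size n₁ n₂ n₃ (inj₂ signed) = signed-row-size n₁ n₂ n₃ signed

sum-transpose : ∀ n₁ n₂ n₃ a₀ a₁ a₂ b₀ b₁ b₂ c₀ c₁ c₂ →
  (n₁ ℕ.* a₀ ℕ.+ n₂ ℕ.* b₀ ℕ.+ n₃ ℕ.* c₀) ℕ.+ (n₁ ℕ.* a₁ ℕ.+ n₂ ℕ.* b₁ ℕ.+ n₃ ℕ.* c₁)
    ℕ.+ (n₁ ℕ.* a₂ ℕ.+ n₂ ℕ.* b₂ ℕ.+ n₃ ℕ.* c₂)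
  ≡ n₁ ℕ.* (a₀ ℕ.+ a₁ ℕ.+ a₂) ℕ.+ n₂ ℕ.* (b₀ ℕ.+ b₁ ℕ.+ b₂) ℕ.+ n₃ ℕ.* (c₀ ℕ.+ c₁ ℕ.+ c₂)
sum-transpose = ℕ-Solver.solve-∀

size-point : ∀ C n₁ n₂ n₃ → Coherent C →
  size (point C n₁ n₂ n₃)
    ≡ n₁ ℕ.* size (Cone.g₁ C) ℕ.+ n₂ ℕ.* size (Cone.g₂ C) ℕ.+ n₃ ℕ.* size (Cone.g₃ C)
size-point (cone x y z) n₁ n₂ n₃ (row₀ , row₁ , row₂) =
  trans (cong₂ ℕ._+_ (cong₂ ℕ._+_ (row-size n₁ n₂ n₃ row₀) (row-size n₁ n₂ n₃ row₁))
                     (row-size n₁ n₂ n₃ row₂))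
        (sum-transpose n₁ n₂ n₃ _ _ _ _ _ _ _ _ _)

weighted-sum-< : ∀ {a₁ a₂ a₃ b₁ b₂ b₃} n₁ n₂ n₃ → a₁ ℕ.< b₁ → a₂ ℕ.< b₂ → a₃ ℕ.< b₃ →
  ¬ (n₁ ≡ 0 × n₂ ≡ 0 × n₃ ≡ 0) →
  n₁ ℕ.* a₁ ℕ.+ n₂ ℕ.* a₂ ℕ.+ n₃ ℕ.* a₃ ℕ.< n₁ ℕ.* b₁ ℕ.+ n₂ ℕ.* b₂ ℕ.+ n₃ ℕ.* b₃
weighted-sum-< (suc k) n₂ n₃ a₁<b₁ a₂<b₂ a₃<b₃ _ =
  ℕ.+-mono-<-≤ (ℕ.+-mono-<-≤ (ℕ.*-monoʳ-< (suc k) a₁<b₁) (ℕ.*-monoʳ-≤ n₂ (ℕ.<⇒≤ a₂<b₂)))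
               (ℕ.*-monoʳ-≤ n₃ (ℕ.<⇒≤ a₃<b₃))
weighted-sum-< zero (suc k) n₃ _ a₂<b₂ a₃<b₃ _ =
  ℕ.+-mono-<-≤ (ℕ.*-monoʳ-< (suc k) a₂<b₂) (ℕ.*-monoʳ-≤ n₃ (ℕ.<⇒≤ a₃<b₃))
weighted-sum-< zero zero (suc k) _ _ a₃<b₃ _ = ℕ.*-monoʳ-< (suc k) a₃<b₃
weighted-sum-< zero zero zero _ _ _ nonzero = contradiction (refl , refl , refl) nonzero

ShrinkingLeaf : Shift → Cone → Set
ShrinkingLeaf d C =
  Coherent C × Coherent (factor d ·ᶜ C) × Generators (λ g → size (factor d · g) ℕ.< size g) C

shrinking-covered : ∀ d C → ShrinkingLeaf d C → Covered C
shrinking-covered d C@(cone x y z) (coherent , coherent′ , x-shrinks , y-shrinks , z-shrinks)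
                  n₁ n₂ n₃ N≡1 =
  inj₂ (d , (begin-strict
    size (factor d · point C n₁ n₂ n₃)
      ≡⟨ cong size (·-combination (factor d) C (+ n₁) (+ n₂) (+ n₃)) ⟩
    size (point (factor d ·ᶜ C) n₁ n₂ n₃)
      ≡⟨ size-point (factor d ·ᶜ C) n₁ n₂ n₃ coherent′ ⟩
    n₁ ℕ.* size (factor d · x) ℕ.+ n₂ ℕ.* size (factor d · y) ℕ.+ n₃ ℕ.* size (factor d · z)
      <⟨ weighted-sum-< n₁ n₂ n₃ x-shrinks y-shrinks z-shrinks nonzero ⟩
    n₁ ℕ.* size x ℕ.+ n₂ ℕ.* size y ℕ.+ n₃ ℕ.* size z
      ≡⟨ size-point C n₁ n₂ n₃ coherent ⟨
    size (point C n₁ n₂ n₃) ∎))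
  where
  open ℕ.≤-Reasoning
  nonzero : ¬ (n₁ ≡ 0 × n₂ ≡ 0 × n₃ ≡ 0)
  nonzero (refl , refl , refl) = origin-not-unit C N≡1

data Certificate : Set where
  split : Pair → Certificate → Certificate → Certificate
  positive negative : Certificate
  shrink : Shift → Certificate

Valid : Certificate → Cone → Set
Valid (split p l r) C = Valid l (lower p C) × Valid r (upper p C)
Valid positive C = PositiveLeaf C
Valid negative C = SignedForm Sign.- (normForm C)
Valid (shrink d) C = ShrinkingLeaf d C

valid? : ∀ t C → Dec (Valid t C)
valid? (split p l r) C = valid? l (lower p C) ×-dec valid? r (upper p C)
valid? positive C =
  signedForm? Sign.+ (normForm C) ×-dec generators? (λ g → 1 ℕ.≤? ∣ norm g ∣ ×-dec descent? g) C
valid? negative C = signedForm? Sign.- (normForm C)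
valid? (shrink d) C =
  coherent? C ×-dec coherent? (factor d ·ᶜ C) ×-dec generators? (λ g → size (factor d · g) ℕ.<? size g) C

covered : ∀ t C → Valid t C → Covered C
covered (split p l r) C (l-valid , r-valid) =
  split-covered p C (covered l _ l-valid) (covered r _ r-valid)
covered positive C valid = positive-covered C valid
covered negative C valid = negative-covered C valid
covered (shrink d) C valid = shrinking-covered d C valid

octant : Sign → Sign → Sign → Cone
octant s₁ s₂ s₃ = cone ⟨ s₁ ◃ 1 , 0ℤ , 0ℤ ⟩ ⟨ 0ℤ , s₂ ◃ 1 , 0ℤ ⟩ ⟨ 0ℤ , 0ℤ , s₃ ◃ 1 ⟩

-- Found by a computer search; octant-valid checks them.
octant-certificate : Sign → Sign → Sign → Certificate
octant-certificate Sign.+ Sign.+ Sign.+ =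
  split ₁₂ (split ₁₃ (split ₂₃ positive positive) (split ₂₃ (split ₁₂ positive (split ₂₃ positive
    (shrink byε⁻¹))) positive)) (split ₁₃ (split ₂₃ positive (split ₁₃ positive positive))
    (split ₂₃ positive positive))
octant-certificate Sign.+ Sign.+ Sign.- =
  split ₁₂ (split ₁₃ (split ₂₃ positive (split ₁₃ positive (split ₂₃ positive (split ₂₃ positive
    (split ₁₃ (shrink byε) (split ₂₃ (shrink byε) negative)))))) (split ₂₃ (split ₁₂ (split ₁₃
    (split ₁₂ (split ₁₃ (split ₁₂ (split ₁₂ negative (shrink byε)) (split ₂₃ positive
    (shrink byε))) (split ₂₃ (split ₁₂ (split ₁₃ (shrink byε) positive) positive) (split ₁₂
    (shrink byε) positive))) positive) positive) positive) (split ₂₃ (split ₁₂ (split ₁₃ (split ₁₂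
    negative (shrink byε)) (shrink byε)) (split ₂₃ (shrink byε) (shrink byε))) negative)))
    (split ₁₃ positive (split ₂₃ (split ₁₂ (split ₁₃ positive (split ₂₃ positive (shrink byε)))
    (split ₂₃ positive (split ₁₃ positive (split ₁₃ positive (split ₂₃ positive (shrink byε))))))
    (split ₁₃ (split ₁₂ (split ₁₃ (shrink byε) (split ₂₃ (shrink byε) negative)) (split ₂₃
    (split ₁₂ (split ₁₃ (shrink byε) (split ₂₃ (shrink byε) negative)) (split ₂₃ (split ₂₃
    (split ₁₂ (split ₁₃ (shrink byε) negative) negative) (split ₁₃ (split ₁₂ (shrink byε) negative)
    negative)) (split ₁₃ (split ₁₂ (shrink byε) negative) negative))) (split ₁₃ (split ₁₂
    (shrink byε) negative) negative))) negative)))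
octant-certificate Sign.+ Sign.- Sign.+ =
  split ₁₂ (split ₁₃ (split ₂₃ (split ₁₂ positive (split ₂₃ (split ₂₃ (shrink byε) positive)
    positive)) positive) (split ₂₃ (split ₁₂ positive (split ₂₃ (split ₁₂ positive (split ₂₃
    (split ₁₂ positive (shrink byε)) positive)) positive)) positive)) (split ₁₃ (split ₂₃ (split ₁₂
    (split ₁₃ negative (split ₂₃ negative (shrink byε))) (split ₂₃ negative (split ₁₃ negative
    (shrink byε)))) (split ₁₃ (shrink byε) positive)) (split ₂₃ (split ₁₂ positive (split ₂₃
    (split ₁₂ (split ₁₃ (shrink byε) negative) negative) (split ₁₃ (split ₁₂ (shrink byε) (split ₂₃
    negative (shrink byε))) (split ₁₃ (split ₁₂ (shrink byε) (split ₂₃ negative (shrink byε)))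
    (split ₂₃ (split ₁₂ (shrink byε) negative) (shrink byε)))))) positive))
octant-certificate Sign.+ Sign.- Sign.- =
  split ₁₂ (split ₁₃ (split ₂₃ (split ₁₂ (split ₁₃ positive (split ₂₃ (shrink byε) (shrink byε)))
    (split ₂₃ (split ₂₃ (split ₁₂ (split ₁₃ (shrink byε) (split ₂₃ (shrink byε) negative))
    (split ₂₃ (split ₁₂ (split ₁₃ (shrink byε) (split ₂₃ (shrink byε) negative)) (split ₂₃
    (split ₂₃ (split ₁₂ (split ₁₃ (shrink byε) negative) negative) (split ₁₃ (split ₁₂ (shrink byε)
    negative) negative)) (split ₁₃ (split ₁₂ (shrink byε) negative) negative))) (split ₁₃ (split ₁₂
    (shrink byε) negative) negative))) (split ₁₃ (split ₁₂ (shrink byε) negative) negative))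
    (split ₁₃ (split ₁₂ (shrink byε) negative) negative))) (split ₁₃ (split ₁₂ positive
    (shrink byε)) (split ₂₃ (shrink byε) (split ₂₃ (shrink byε) (split ₁₃ (shrink byε)
    negative))))) negative) negative
octant-certificate Sign.- Sign.+ Sign.+ =
  split ₁₂ (split ₁₃ (split ₂₃ (split ₁₂ (split ₁₃ negative (split ₂₃ (shrink byε) (shrink byε)))
    (split ₂₃ (split ₂₃ (split ₁₂ (split ₁₃ (shrink byε) (split ₂₃ (shrink byε) positive))
    (split ₂₃ (split ₁₂ (split ₁₃ (shrink byε) (split ₂₃ (shrink byε) positive)) (split ₂₃
    (split ₂₃ (split ₁₂ (split ₁₃ (shrink byε) positive) positive) (split ₁₃ (split ₁₂ (shrink byε)
    positive) positive)) (split ₁₃ (split ₁₂ (shrink byε) positive) positive))) (split ₁₃ (split ₁₂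
    (shrink byε) positive) positive))) (split ₁₃ (split ₁₂ (shrink byε) positive) positive))
    (split ₁₃ (split ₁₂ (shrink byε) positive) positive))) (split ₁₃ (split ₁₂ negative
    (shrink byε)) (split ₂₃ (shrink byε) (split ₂₃ (shrink byε) (split ₁₃ (shrink byε)
    positive))))) positive) positive
octant-certificate Sign.- Sign.+ Sign.- =
  split ₁₂ (split ₁₃ (split ₂₃ (split ₁₂ negative (split ₂₃ (split ₂₃ (shrink byε) negative)
    negative)) negative) (split ₂₃ (split ₁₂ negative (split ₂₃ (split ₁₂ negative (split ₂₃
    (split ₁₂ negative (shrink byε)) negative)) negative)) negative)) (split ₁₃ (split ₂₃ (split ₁₂
    (split ₁₃ positive (split ₂₃ positive (shrink byε))) (split ₂₃ positive (split ₁₃ positive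
    (shrink byε)))) (split ₁₃ (shrink byε) negative)) (split ₂₃ (split ₁₂ negative (split ₂₃
    (split ₁₂ (split ₁₃ (shrink byε) positive) positive) (split ₁₃ (split ₁₂ (shrink byε) (split ₂₃
    positive (shrink byε))) (split ₁₃ (split ₁₂ (shrink byε) (split ₂₃ positive (shrink byε)))
    (split ₂₃ (split ₁₂ (shrink byε) positive) (shrink byε)))))) negative))
octant-certificate Sign.- Sign.- Sign.+ =
  split ₁₂ (split ₁₃ (split ₂₃ negative (split ₁₃ negative (split ₂₃ negative (split ₂₃ negative
    (split ₁₃ (shrink byε) (split ₂₃ (shrink byε) positive)))))) (split ₂₃ (split ₁₂ (split ₁₃
    (split ₁₂ (split ₁₃ (split ₁₂ (split ₁₂ positive (shrink byε)) (split ₂₃ negative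
    (shrink byε))) (split ₂₃ (split ₁₂ (split ₁₃ (shrink byε) negative) negative) (split ₁₂
    (shrink byε) negative))) negative) negative) negative) (split ₂₃ (split ₁₂ (split ₁₃ (split ₁₂
    positive (shrink byε)) (shrink byε)) (split ₂₃ (shrink byε) (shrink byε))) positive)))
    (split ₁₃ negative (split ₂₃ (split ₁₂ (split ₁₃ negative (split ₂₃ negative (shrink byε)))
    (split ₂₃ negative (split ₁₃ negative (split ₁₃ negative (split ₂₃ negative (shrink byε))))))
    (split ₁₃ (split ₁₂ (split ₁₃ (shrink byε) (split ₂₃ (shrink byε) positive)) (split ₂₃
    (split ₁₂ (split ₁₃ (shrink byε) (split ₂₃ (shrink byε) positive)) (split ₂₃ (split ₂₃
    (split ₁₂ (split ₁₃ (shrink byε) positive) positive) (split ₁₃ (split ₁₂ (shrink byε) positive)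
    positive)) (split ₁₃ (split ₁₂ (shrink byε) positive) positive))) (split ₁₃ (split ₁₂
    (shrink byε) positive) positive))) positive)))
octant-certificate Sign.- Sign.- Sign.- =
  split ₁₂ (split ₁₃ (split ₂₃ negative negative) (split ₂₃ (split ₁₂ negative (split ₂₃ negative
    (shrink byε⁻¹))) negative)) (split ₁₃ (split ₂₃ negative (split ₁₃ negative negative))
    (split ₂₃ negative negative))

octant-valid : ∀ s₁ s₂ s₃ → Valid (octant-certificate s₁ s₂ s₃) (octant s₁ s₂ s₃)
octant-valid s₁ s₂ s₃ = toWitness (checked s₁ s₂ s₃)
  where
  checked : ∀ s₁ s₂ s₃ → True (valid? (octant-certificate s₁ s₂ s₃) (octant s₁ s₂ s₃))
  checked Sign.+ Sign.+ Sign.+ = _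
  checked Sign.+ Sign.+ Sign.- = _
  checked Sign.+ Sign.- Sign.+ = _
  checked Sign.+ Sign.- Sign.- = _
  checked Sign.- Sign.+ Sign.+ = _
  checked Sign.- Sign.+ Sign.- = _
  checked Sign.- Sign.- Sign.+ = _
  checked Sign.- Sign.- Sign.- = _

abs-*-sign : ∀ i → + ∣ i ∣ * (sign i ◃ 1) ≡ i
abs-*-sign (+ n) = ℤ.*-identityʳ (+ n)
abs-*-sign -[1+ n ] = trans (ℤ.*-comm (+ suc n) -1ℤ) (ℤ.-1*i≡-i (+ suc n))

combination-diagonal : ∀ σ₁ σ₂ σ₃ t₁ t₂ t₃ →
  combination (cone ⟨ σ₁ , 0ℤ , 0ℤ ⟩ ⟨ 0ℤ , σ₂ , 0ℤ ⟩ ⟨ 0ℤ , 0ℤ , σ₃ ⟩) t₁ t₂ t₃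
    ≡ ⟨ t₁ * σ₁ , t₂ * σ₂ , t₃ * σ₃ ⟩
combination-diagonal σ₁ σ₂ σ₃ t₁ t₂ t₃ =
  proveθ (σ₁ ∷ σ₂ ∷ σ₃ ∷ t₁ ∷ t₂ ∷ t₃ ∷ [])
    (combinationᵖ ⟨ S₁ , 0ᵖ , 0ᵖ ⟩ᵖ ⟨ 0ᵖ , S₂ , 0ᵖ ⟩ᵖ ⟨ 0ᵖ , 0ᵖ , S₃ ⟩ᵖ R₁ R₂ R₃)
    ⟨ R₁ :* S₁ , R₂ :* S₂ , R₃ :* S₃ ⟩ᵖ refl
  where
  0ᵖ S₁ S₂ S₃ R₁ R₂ R₃ : Polynomial 6
  0ᵖ = con 0ℤ
  S₁ = var (# 0); S₂ = var (# 1); S₃ = var (# 2); R₁ = var (# 3); R₂ = var (# 4); R₃ = var (# 5)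

descent : ∀ v → Descent v
descent v@(⟨ a , b , c ⟩) = subst Descent in-octant
  (covered (octant-certificate (sign a) (sign b) (sign c)) (octant (sign a) (sign b) (sign c))
           (octant-valid (sign a) (sign b) (sign c)) (∣ a ∣) (∣ b ∣) (∣ c ∣))
  where
  in-octant : point (octant (sign a) (sign b) (sign c)) (∣ a ∣) (∣ b ∣) (∣ c ∣) ≡ v
  in-octant =
    trans (combination-diagonal (sign a ◃ 1) (sign b ◃ 1) (sign c ◃ 1) (+ ∣ a ∣) (+ ∣ b ∣) (+ ∣ c ∣))
          (Z3-ext (abs-*-sign a) (abs-*-sign b) (abs-*-sign c))

-- Every unit of norm 1 is a power of ε

ε·ε⁻¹· : ∀ v → ε · (ε⁻¹ · v) ≡ v
ε·ε⁻¹· v = proveθ (v ∷ᶻ []) (constᵖ ε ·ᵖ (constᵖ ε⁻¹ ·ᵖ X)) X refl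

ε⁻¹·ε· : ∀ v → ε⁻¹ · (ε · v) ≡ v
ε⁻¹·ε· v = proveθ (v ∷ᶻ []) (constᵖ ε⁻¹ ·ᵖ (constᵖ ε ·ᵖ X)) X refl

ε·εpow : ∀ k → ε · εpow k ≡ εpow (sucℤ k)
ε·εpow (+ n) = refl
ε·εpow -[1+ zero ] = refl
ε·εpow -[1+ suc n ] = ε·ε⁻¹· (pow ε⁻¹ (suc n))

ε⁻¹·εpow : ∀ k → ε⁻¹ · εpow k ≡ εpow (predℤ k)
ε⁻¹·εpow (+ zero) = refl
ε⁻¹·εpow (+ suc n) = ε⁻¹·ε· (pow ε n)
ε⁻¹·εpow -[1+ n ] = refl

norm-factor· : ∀ d v → norm (factor d · v) ≡ norm v
norm-factor· byε v = trans (norm-· ε v) (ℤ.*-identityˡ (norm v))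
norm-factor· byε⁻¹ v = trans (norm-· ε⁻¹ v) (ℤ.*-identityˡ (norm v))

unfactor : ∀ d {v k} → factor d · v ≡ εpow k → ∃[ k′ ] v ≡ εpow k′
unfactor byε {v} {k} εv≡εᵏ = predℤ k , (begin
  v                 ≡⟨ ε⁻¹·ε· v ⟨
  ε⁻¹ · (ε · v)     ≡⟨ cong (ε⁻¹ ·_) εv≡εᵏ ⟩
  ε⁻¹ · εpow k      ≡⟨ ε⁻¹·εpow k ⟩
  εpow (predℤ k)   ∎)
  where open ≡-Reasoning
unfactor byε⁻¹ {v} {k} ε⁻¹v≡εᵏ = sucℤ k , (begin
  v                 ≡⟨ ε·ε⁻¹· v ⟨
  ε · (ε⁻¹ · v)     ≡⟨ cong (ε ·_) ε⁻¹v≡εᵏ ⟩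
  ε · εpow k        ≡⟨ ε·εpow k ⟩
  εpow (sucℤ k)    ∎)
  where open ≡-Reasoning

norm≡1⇒εpow : ∀ η → norm η ≡ 1ℤ → ∃[ k ] η ≡ εpow k
norm≡1⇒εpow η = go (suc (size η)) η ℕ.≤-refl
  where
  go : ∀ fuel v → size v ℕ.< fuel → norm v ≡ 1ℤ → ∃[ k ] v ≡ εpow k
  go (suc fuel) v (s≤s size≤fuel) N≡1 = continue (descent v N≡1)
    where
    continue : v ≡ one ⊎ ∃[ d ] size (factor d · v) ℕ.< size v → ∃[ k ] v ≡ εpow k
    continue (inj₁ v≡1) = 0ℤ , v≡1
    continue (inj₂ (d , smaller)) =
      let k , dv≡εᵏ = go fuel (factor d · v) (ℕ.≤-trans smaller size≤fuel) (trans (norm-factor· d v) N≡1)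
      in unfactor d {k = k} dv≡εᵏ

*-cancel-positive : ∀ {m x} → m > 0ℤ → m ≡ m * x → x ≡ 1ℤ
*-cancel-positive {m} {x} m>0 m≡mx =
  ℤ.*-cancelˡ-≡ m x 1ℤ {{>-nonZero m>0}} (trans (sym m≡mx) (sym (ℤ.*-identityʳ m)))

∣θ⇒SameOrbit : ∀ {x y} → norm x > 0ℤ → norm x ≡ norm y → x ∣θ y → SameOrbit x y
∣θ⇒SameOrbit {x} Nx>0 Nx≡Ny (dividesθ η refl) =
  let k , η≡εᵏ = norm≡1⇒εpow η (*-cancel-positive Nx>0 (trans Nx≡Ny (norm-· x η)))
  in k , inj₁ (trans (cong (x ·_) η≡εᵏ) (·-comm x (εpow k)))

same-m-and-ν⇒SameOrbit : (a b c u v w a′ b′ c′ u′ v′ w′ : ℤ) →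
  Hyp a b c u v w → Hyp a′ b′ c′ u′ v′ w′ →
  normM a b c ≡ normM a′ b′ c′ → normM a b c Unsigned.∣ (nu a b c u v w - nu a′ b′ c′ u′ v′ w′) →
  SameOrbit ⟨ a , b , c ⟩ ⟨ a′ , b′ , c′ ⟩
same-m-and-ν⇒SameOrbit a b c u v w a′ b′ c′ u′ v′ w′ (_ , m>0 , bezout) (_ , _ , bezout′) m≡m′ m∣ν-ν′ =
  ∣θ⇒SameOrbit m>0 m≡m′ (I.m∣evalAt⇒∣θ (subst (I.m ∣_) (sym (evalAt-difference α′ I.ν I′.ν)) m∣α′[ν]))
  where
  module I = Ideal a b c u v w bezout
  module I′ = Ideal a′ b′ c′ u′ v′ w′ bezout′
  α′ = ⟨ a′ , b′ , c′ ⟩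
  m∣α′[ν] : I.m ∣ evalAt α′ I′.ν + (I.ν - I′.ν) * (b′ + c′ * (I.ν + I′.ν))
  m∣α′[ν] = ∣m∣n⇒∣m+n (subst (_∣ evalAt α′ I′.ν) (sym m≡m′) I′.m∣evalAt-ν)
                      (∣m⇒∣m*n _ (∣ᵤ⇒∣ {i = I.ν - I′.ν} m∣ν-ν′))

lemma2 :
    ((a b c u v w : ℤ) → Hyp a b c u v w →
        normM a b c Unsigned.∣ (nu a b c u v w ^ 3 - + 2))
    × ((a b c u v w a′ b′ c′ u′ v′ w′ : ℤ) →
        Hyp a b c u v w → Hyp a′ b′ c′ u′ v′ w′ →
        ¬ SameOrbit ⟨ a , b , c ⟩ ⟨ a′ , b′ , c′ ⟩ →
        ¬ ((normM a b c ≡ normM a′ b′ c′)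
            × (normM a b c Unsigned.∣ (nu a b c u v w - nu a′ b′ c′ u′ v′ w′))))
lemma2 =
  (λ a b c u v w (_ , _ , bezout) → ∣⇒∣ᵤ (Ideal.m∣ν³-2 a b c u v w bezout)) ,
  λ a b c u v w a′ b′ c′ u′ v′ w′ hyp hyp′ different (m≡m′ , m∣ν-ν′) →
    different (same-m-and-ν⇒SameOrbit a b c u v w a′ b′ c′ u′ v′ w′ hyp hyp′ m≡m′ m∣ν-ν′)
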